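{- Let $\Gamma$ be a finite undirected multigraph (self-loops and parallel edges allowed) with vertex set $V$ and edge set $E$, and fix a vertex $v\in V$. Let $G$ be any subset of $E$, and assume $E\neq\varnothing$. Then \[ \sum_{\substack{F\subseteq E;\\ G\subseteq \operatorname{Shade}F}}(-1)^{|F|}=0 . \]
   Context: For $F\subseteq E$, an $F$-path is a path of $\Gamma$ all of whose edges belong to $F$ (an edgeless path is allowed). For $e\in E$ and $F\subseteq E$, $F$ infects $e$ if there is an $F$-path from $v$ to some endpoint of $e$. The shade of $F\subseteq E$ is $\operatorname{Shade}F=\{e\in E \mid F\text{ infects }e\}$. -}

module Defs where

open import Data.Nat using (ℕ; zero; suc)
open import Data.Fin using (Fin)
open import Data.Fin.Subset using (Subset; _∈_; ∣_∣; inside; outside)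
open import Data.Integer using (ℤ; _+_; _^_; -1ℤ; 0ℤ)
open import Data.Product using (_×_; proj₁; proj₂)
open import Data.Sum using (_⊎_)
open import Data.Vec using (_∷_; [])
open import Relation.Nullary using (Dec; does)
open import Data.Bool using (if_then_else_)
open import Relation.Binary.PropositionalEquality using (_≡_)

-- A finite undirected multigraph Γ with vertex set V = Fin nV and edge set
-- E = Fin nE; edge e has (unordered) endpoints ends e.
record Multigraph : Set where
  field
    nV   : ℕ
    nE   : ℕ
    ends : Fin nE → Fin nV × Fin nV

open Multigraph public

Vert : Multigraph → Set
Vert Γ = Fin (nV Γ)

Edge : Multigraph → Set
Edge Γ = Fin (nE Γ)

Joins : (Γ : Multigraph) → Edge Γ → Vert Γ → Vert Γ → Set
Joins Γ e a b = (proj₁ (ends Γ e) ≡ a × proj₂ (ends Γ e) ≡ b)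
              ⊎ (proj₁ (ends Γ e) ≡ b × proj₂ (ends Γ e) ≡ a)

data FPath (Γ : Multigraph) (F : Subset (nE Γ)) : Vert Γ → Vert Γ → Set where
  []  : ∀ {a} → FPath Γ F a a
  _∷_ : ∀ {a b c} {e : Edge Γ} → (e ∈ F × Joins Γ e a b) → FPath Γ F b c → FPath Γ F a c

Infects : (Γ : Multigraph) → Vert Γ → Subset (nE Γ) → Edge Γ → Set
Infects Γ v F e = FPath Γ F v (proj₁ (ends Γ e)) ⊎ FPath Γ F v (proj₂ (ends Γ e))

GSubShade : (Γ : Multigraph) (v : Vert Γ) (G F : Subset (nE Γ)) → Set
GSubShade Γ v G F = ∀ e → e ∈ G → Infects Γ v F e

sumSubsets : (m : ℕ) → (Subset m → ℤ) → ℤ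
sumSubsets zero    f = f []
sumSubsets (suc m) f = sumSubsets m (λ s → f (outside ∷ s)) + sumSubsets m (λ s → f (inside ∷ s))

signedCount : (m : ℕ) (P : Subset m → Set) → (∀ F → Dec (P F)) → ℤ
signedCount m P P? = sumSubsets m (λ F → if does (P? F) then -1ℤ ^ ∣ F ∣ else 0ℤ)

-- Generalise the single vertex v to an arbitrary list S of seed vertices and
-- induct on the number of edges.  If no edge has an endpoint in S, nothing is
-- reachable beyond S, so the condition does not depend on F and toggling one
-- edge is a sign-reversing involution.  Otherwise pick an edge k with an
-- endpoint in S; k is then always infected.  Subsets F ∌ k see the graph
-- Γ ∖ k with the same seeds, and subsets F ∋ k see Γ ∖ k with both endpoints
-- of k added to the seeds, the extra edge contributing a sign −1.  Hence the
-- sum is the difference of two sums over Γ ∖ k which differ only in their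
-- seeds; by induction both vanish, and with no edge left both equal 1.
module Submission where

open import Defs

open import Algebra.Properties.CommutativeSemigroup using (interchange)
open import Data.Bool using (true; false; if_then_else_)
open import Data.Fin using (Fin; zero; suc; punchIn)
open import Data.Fin.Properties using (any?; punchIn-punchOut) renaming (_≟_ to _≟ᶠ_)
open import Data.Fin.Subset using (Subset; inside; outside; ∣_∣) renaming (_∈_ to _∈ˢ_)
open import Data.Integer using (ℤ; _+_; _-_; -_; _*_; _^_; 0ℤ; 1ℤ; -1ℤ)
open import Data.Integer.Properties using (+-commutativeSemigroup; neg-distrib-+; -1*i≡-i; i≡j⇒i-j≡0)
open import Data.List using (List; []; _∷_; [_])
open import Data.List.Membership.Propositional using () renaming (_∈_ to _∈ˡ_)
import Data.List.Membership.DecPropositional as DecMembership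
open import Data.List.Relation.Unary.Any using (here; there)
open import Data.Nat using (ℕ; zero; suc)
open import Data.Product using (∃-syntax; _×_; _,_; proj₁; proj₂)
open import Data.Sum using (_⊎_; inj₁; inj₂; swap) renaming (map to map-⊎)
open import Data.Vec using (Vec; _∷_; []; lookup; insertAt; removeAt)
open import Data.Vec.Properties using (insertAt-lookup; insertAt-punchIn; []=⇒lookup; lookup⇒[]=)
open import Function using (_∘_)
open import Function.Bundles using (_⇔_; mk⇔; Equivalence)
open import Relation.Nullary using (Dec; yes; no; does; ¬_; contradiction)
open import Relation.Nullary.Decidable using (does-⇔; map; _⊎-dec_)
open import Relation.Binary.PropositionalEquality
  using (_≡_; refl; sym; trans; cong; cong₂; subst; module ≡-Reasoning)

open Equivalence using (to; from)

data PunchInView {m : ℕ} (k : Fin (suc m)) : Fin (suc m) → Set where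
  at      : PunchInView k k
  punched : (e : Fin m) → PunchInView k (punchIn k e)

punchInView : ∀ {m} (k e : Fin (suc m)) → PunchInView k e
punchInView k e with k ≟ᶠ e
... | yes refl = at
... | no k≢e   = subst (PunchInView k) (punchIn-punchOut k≢e) (punched _)

removeAt-punchIn : ∀ {A : Set} {m} (xs : Vec A (suc m)) (k : Fin (suc m)) (e : Fin m) →
                   lookup (removeAt xs k) e ≡ lookup xs (punchIn k e)
removeAt-punchIn (x ∷ xs)     zero    e       = refl
removeAt-punchIn (x ∷ y ∷ xs) (suc k) zero    = refl
removeAt-punchIn (x ∷ y ∷ xs) (suc k) (suc e) = removeAt-punchIn (y ∷ xs) k e

module _ {m : ℕ} (k : Fin (suc m)) where

  ∈-insertAt-self : ∀ (F : Subset m) → k ∈ˢ insertAt F k inside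
  ∈-insertAt-self F = lookup⇒[]= k _ (insertAt-lookup F k inside)

  ∉-insertAt-self : ∀ (F : Subset m) → ¬ (k ∈ˢ insertAt F k outside)
  ∉-insertAt-self F k∈ with trans (sym (insertAt-lookup F k outside)) ([]=⇒lookup k∈)
  ... | ()

  ∈-insertAt⁺ : ∀ {F : Subset m} {e x} → e ∈ˢ F → punchIn k e ∈ˢ insertAt F k x
  ∈-insertAt⁺ {F} {e} {x} e∈ = lookup⇒[]= _ _ (trans (insertAt-punchIn F k x e) ([]=⇒lookup e∈))

  ∈-insertAt⁻ : ∀ {F : Subset m} {e x} → punchIn k e ∈ˢ insertAt F k x → e ∈ˢ F
  ∈-insertAt⁻ {F} {e} {x} e∈ = lookup⇒[]= _ _ (trans (sym (insertAt-punchIn F k x e)) ([]=⇒lookup e∈))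

  ∈-removeAt⁺ : ∀ {G : Subset (suc m)} {e} → punchIn k e ∈ˢ G → e ∈ˢ removeAt G k
  ∈-removeAt⁺ {G} {e} e∈ = lookup⇒[]= _ _ (trans (removeAt-punchIn G k e) ([]=⇒lookup e∈))

  ∈-removeAt⁻ : ∀ {G : Subset (suc m)} {e} → e ∈ˢ removeAt G k → punchIn k e ∈ˢ G
  ∈-removeAt⁻ {G} {e} e∈ = lookup⇒[]= _ _ (trans (sym (removeAt-punchIn G k e)) ([]=⇒lookup e∈))

∣insertAt-outside∣ : ∀ {m} (F : Subset m) k → ∣ insertAt F k outside ∣ ≡ ∣ F ∣
∣insertAt-outside∣ F             zero    = refl
∣insertAt-outside∣ (outside ∷ F) (suc k) = ∣insertAt-outside∣ F k
∣insertAt-outside∣ (inside ∷ F)  (suc k) = cong suc (∣insertAt-outside∣ F k)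

∣insertAt-inside∣ : ∀ {m} (F : Subset m) k → ∣ insertAt F k inside ∣ ≡ suc ∣ F ∣
∣insertAt-inside∣ F             zero    = refl
∣insertAt-inside∣ (outside ∷ F) (suc k) = ∣insertAt-inside∣ F k
∣insertAt-inside∣ (inside ∷ F)  (suc k) = cong suc (∣insertAt-inside∣ F k)

sumSubsets-cong : ∀ m {f g : Subset m → ℤ} → (∀ F → f F ≡ g F) → sumSubsets m f ≡ sumSubsets m g
sumSubsets-cong zero    f≗g = f≗g []
sumSubsets-cong (suc m) f≗g =
  cong₂ _+_ (sumSubsets-cong m (f≗g ∘ (outside ∷_))) (sumSubsets-cong m (f≗g ∘ (inside ∷_)))

sumSubsets-neg : ∀ m (f : Subset m → ℤ) → sumSubsets m (-_ ∘ f) ≡ - sumSubsets m f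
sumSubsets-neg zero    f = refl
sumSubsets-neg (suc m) f =
  trans (cong₂ _+_ (sumSubsets-neg m (f ∘ (outside ∷_))) (sumSubsets-neg m (f ∘ (inside ∷_))))
        (sym (neg-distrib-+ (sumSubsets m (f ∘ (outside ∷_))) (sumSubsets m (f ∘ (inside ∷_)))))

sumSubsets-insertAt : ∀ m (k : Fin (suc m)) (f : Subset (suc m) → ℤ) →
  sumSubsets (suc m) f ≡ sumSubsets m (λ F → f (insertAt F k outside))
                       + sumSubsets m (λ F → f (insertAt F k inside))
sumSubsets-insertAt m       zero    f = refl
sumSubsets-insertAt (suc m) (suc k) f =
  trans (cong₂ _+_ (sumSubsets-insertAt m k (f ∘ (outside ∷_))) (sumSubsets-insertAt m k (f ∘ (inside ∷_))))
        (interchange +-commutativeSemigroup (sumSubsets m (f ∘ (outside ∷_) ∘ out)) (sumSubsets m (f ∘ (outside ∷_) ∘ inn))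
                     (sumSubsets m (f ∘ (inside ∷_) ∘ out))  (sumSubsets m (f ∘ (inside ∷_) ∘ inn)))
  where
  out inn : Subset m → Subset (suc m)
  out F = insertAt F k outside
  inn F = insertAt F k inside

signedTerm : ∀ {m} {P : Subset m → Set} → (∀ F → Dec (P F)) → Subset m → ℤ
signedTerm P? F = if does (P? F) then -1ℤ ^ ∣ F ∣ else 0ℤ

signedCount-cong : ∀ m {P Q : Subset m → Set} (P? : ∀ F → Dec (P F)) (Q? : ∀ F → Dec (Q F)) →
                   (∀ F → P F ⇔ Q F) → signedCount m P P? ≡ signedCount m Q Q?
signedCount-cong m P? Q? P⇔Q = sumSubsets-cong m λ F →
  cong (λ b → if b then -1ℤ ^ ∣ F ∣ else 0ℤ) (does-⇔ (P⇔Q F) (P? F) (Q? F))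

signedCount-zero : ∀ {P : Subset 0 → Set} (P? : ∀ F → Dec (P F)) → P [] → signedCount 0 P P? ≡ 1ℤ
signedCount-zero P? p with P? []
... | yes _  = refl
... | no ¬p = contradiction p ¬p

if-then-neg : ∀ b (x : ℤ) → (if b then -1ℤ * x else 0ℤ) ≡ - (if b then x else 0ℤ)
if-then-neg true  x = -1*i≡-i x
if-then-neg false x = refl

signedCount-split : ∀ {m} (k : Fin (suc m)) {P : Subset (suc m) → Set} (P? : ∀ F → Dec (P F)) →
  signedCount (suc m) P P? ≡
    signedCount m (λ F → P (insertAt F k outside)) (λ F → P? (insertAt F k outside))
  - signedCount m (λ F → P (insertAt F k inside)) (λ F → P? (insertAt F k inside))
signedCount-split {m} k P? = begin
  sumSubsets (suc m) (signedTerm P?)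
    ≡⟨ sumSubsets-insertAt m k (signedTerm P?) ⟩
  sumSubsets m (signedTerm P? ∘ out) + sumSubsets m (signedTerm P? ∘ inn)
    ≡⟨ cong₂ _+_ (sumSubsets-cong m term-out) (sumSubsets-cong m term-inn) ⟩
  sumSubsets m (signedTerm (P? ∘ out)) + sumSubsets m (-_ ∘ signedTerm (P? ∘ inn))
    ≡⟨ cong (sumSubsets m (signedTerm (P? ∘ out)) +_) (sumSubsets-neg m (signedTerm (P? ∘ inn))) ⟩
  sumSubsets m (signedTerm (P? ∘ out)) - sumSubsets m (signedTerm (P? ∘ inn)) ∎
  where
  open ≡-Reasoning
  out inn : Subset m → Subset (suc m)
  out F = insertAt F k outside
  inn F = insertAt F k inside

  term-out : ∀ F → signedTerm P? (out F) ≡ signedTerm (P? ∘ out) F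
  term-out F = cong (λ n → if does (P? (out F)) then -1ℤ ^ n else 0ℤ) (∣insertAt-outside∣ F k)

  term-inn : ∀ F → signedTerm P? (inn F) ≡ - signedTerm (P? ∘ inn) F
  term-inn F = trans (cong (λ n → if does (P? (inn F)) then -1ℤ ^ n else 0ℤ) (∣insertAt-inside∣ F k))
                     (if-then-neg (does (P? (inn F))) (-1ℤ ^ ∣ F ∣))

signedCount-toggle : ∀ {m} (k : Fin (suc m)) {P : Subset (suc m) → Set} (P? : ∀ F → Dec (P F)) →
  (∀ F → P (insertAt F k outside) ⇔ P (insertAt F k inside)) → signedCount (suc m) P P? ≡ 0ℤ
signedCount-toggle {m} k P? toggle =
  trans (signedCount-split k P?) (i≡j⇒i-j≡0 (signedCount-cong m (P? ∘ out) (P? ∘ inn) toggle))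
  where
  out inn : Subset m → Subset (suc m)
  out F = insertAt F k outside
  inn F = insertAt F k inside

graph : ∀ {n m} → (Fin m → Fin n × Fin n) → Multigraph
graph {n} {m} inc = record { nV = n ; nE = m ; ends = inc }

AtSomeEnd : (Γ : Multigraph) → (Vert Γ → Set) → Edge Γ → Set
AtSomeEnd Γ R e = R (proj₁ (ends Γ e)) ⊎ R (proj₂ (ends Γ e))

Reachable : (Γ : Multigraph) → List (Vert Γ) → Subset (nE Γ) → Vert Γ → Set
Reachable Γ S F a = ∃[ s ] s ∈ˡ S × FPath Γ F s a

Covers : (Γ : Multigraph) → (Vert Γ → Set) → Subset (nE Γ) → Set
Covers Γ R G = ∀ e → e ∈ˢ G → AtSomeEnd Γ R e

GSubShadeFrom : (Γ : Multigraph) → List (Vert Γ) → (G F : Subset (nE Γ)) → Set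
GSubShadeFrom Γ S G F = Covers Γ (Reachable Γ S F) G

GSubShade⇔GSubShadeFrom-singleton : ∀ {Γ} v {G F} → GSubShade Γ v G F ⇔ GSubShadeFrom Γ [ v ] G F
GSubShade⇔GSubShadeFrom-singleton {Γ} v = mk⇔
  (λ shade e e∈G → map-⊎ to-v to-v (shade e e∈G))
  (λ shade e e∈G → map-⊎ from-v from-v (shade e e∈G))
  where
  to-v : ∀ {F a} → FPath Γ F v a → Reachable Γ [ v ] F a
  to-v p = v , here refl , p
  from-v : ∀ {F a} → Reachable Γ [ v ] F a → FPath Γ F v a
  from-v (_ , here refl , p) = p

_++ᶠ_ : ∀ {Γ F a b c} → FPath Γ F a b → FPath Γ F b c → FPath Γ F a c
[]      ++ᶠ q = q
(x ∷ p) ++ᶠ q = x ∷ (p ++ᶠ q)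

Reachable-extend : ∀ {Γ S F a b} → Reachable Γ S F a → FPath Γ F a b → Reachable Γ S F b
Reachable-extend (s , s∈S , p) q = s , s∈S , p ++ᶠ q

Joins-sym : ∀ {Γ e a b} → Joins Γ e a b → Joins Γ e b a
Joins-sym = swap

Joins⇒AtSomeEnd : ∀ {Γ e a b} {R : Vert Γ → Set} → Joins Γ e a b → R a → AtSomeEnd Γ R e
Joins⇒AtSomeEnd (inj₁ (refl , _)) r = inj₁ r
Joins⇒AtSomeEnd (inj₂ (_ , refl)) r = inj₂ r

seeds-reachable : ∀ {Γ S F} {e : Edge Γ} → AtSomeEnd Γ (_∈ˡ S) e → AtSomeEnd Γ (Reachable Γ S F) e
seeds-reachable = map-⊎ (λ s∈S → _ , s∈S , []) (λ s∈S → _ , s∈S , [])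

module EdgeDeletion {n m : ℕ} (inc : Fin (suc m) → Fin n × Fin n) (k : Fin (suc m)) where

  Γ Γ∖k : Multigraph
  Γ   = graph inc
  Γ∖k = graph (inc ∘ punchIn k)

  k₁ k₂ : Fin n
  k₁ = proj₁ (inc k)
  k₂ = proj₂ (inc k)

  FPath-lift : ∀ {F x a b} → FPath Γ∖k F a b → FPath Γ (insertAt F k x) a b
  FPath-lift []             = []
  FPath-lift ((e∈ , j) ∷ p) = (∈-insertAt⁺ k e∈ , j) ∷ FPath-lift p

  FPath-outside : ∀ {F a b} → FPath Γ (insertAt F k outside) a b → FPath Γ∖k F a b
  FPath-outside [] = []
  FPath-outside (_∷_ {e = e} (e∈ , j) p) with punchInView k e
  ... | at         = contradiction e∈ (∉-insertAt-self k _)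
  ... | punched e′ = (∈-insertAt⁻ k e∈ , j) ∷ FPath-outside p

  -- Cut the path after its last use of k.
  FPath-inside : ∀ {F a b} → FPath Γ (insertAt F k inside) a b →
                 FPath Γ∖k F a b ⊎ AtSomeEnd Γ (λ c → FPath Γ∖k F c b) k
  FPath-inside [] = inj₁ []
  FPath-inside (_∷_ {e = e} (e∈ , j) p) with FPath-inside p | punchInView k e
  ... | inj₂ q | _          = inj₂ q
  ... | inj₁ q | at         = inj₂ (Joins⇒AtSomeEnd {Γ} {R = λ c → FPath Γ∖k _ c _} (Joins-sym {Γ} j) q)
  ... | inj₁ q | punched e′ = inj₁ ((∈-insertAt⁻ k e∈ , j) ∷ q)

  cross-k₁k₂ : ∀ {F} → k ∈ˢ insertAt F k inside × Joins Γ k k₁ k₂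
  cross-k₁k₂ {F} = ∈-insertAt-self k F , inj₁ (refl , refl)

  cross-k₂k₁ : ∀ {F} → k ∈ˢ insertAt F k inside × Joins Γ k k₂ k₁
  cross-k₂k₁ {F} = ∈-insertAt-self k F , inj₂ (refl , refl)

  k₁-reachable : ∀ {S F} → AtSomeEnd Γ (_∈ˡ S) k → Reachable Γ S (insertAt F k inside) k₁
  k₁-reachable (inj₁ k₁∈S) = k₁ , k₁∈S , []
  k₁-reachable (inj₂ k₂∈S) = k₂ , k₂∈S , cross-k₂k₁ ∷ []

  k₂-reachable : ∀ {S F} → AtSomeEnd Γ (_∈ˡ S) k → Reachable Γ S (insertAt F k inside) k₂
  k₂-reachable (inj₁ k₁∈S) = k₁ , k₁∈S , cross-k₁k₂ ∷ []
  k₂-reachable (inj₂ k₂∈S) = k₂ , k₂∈S , []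

  Reachable-outside : ∀ {S F} a → Reachable Γ S (insertAt F k outside) a ⇔ Reachable Γ∖k S F a
  Reachable-outside _ = mk⇔ (λ (s , s∈S , p) → s , s∈S , FPath-outside p)
                          (λ (s , s∈S , p) → s , s∈S , FPath-lift p)

  -- Using k is the same as starting at an endpoint of k, once one endpoint is a seed.
  Reachable-inside : ∀ {S F} → AtSomeEnd Γ (_∈ˡ S) k → ∀ a →
                     Reachable Γ S (insertAt F k inside) a ⇔ Reachable Γ∖k (k₁ ∷ k₂ ∷ S) F a
  Reachable-inside {S} {F} touch a = mk⇔ to-contracted from-contracted
    where
    to-contracted : Reachable Γ S (insertAt F k inside) a → Reachable Γ∖k (k₁ ∷ k₂ ∷ S) F a
    to-contracted (s , s∈S , p) with FPath-inside p
    ... | inj₁ q        = s , there (there s∈S) , q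
    ... | inj₂ (inj₁ q) = k₁ , here refl , q
    ... | inj₂ (inj₂ q) = k₂ , there (here refl) , q

    from-contracted : Reachable Γ∖k (k₁ ∷ k₂ ∷ S) F a → Reachable Γ S (insertAt F k inside) a
    from-contracted (s , there (there s∈S) , q) = s , s∈S , FPath-lift q
    from-contracted (_ , here refl , q)         = Reachable-extend (k₁-reachable touch) (FPath-lift q)
    from-contracted (_ , there (here refl) , q) = Reachable-extend (k₂-reachable touch) (FPath-lift q)

  Covers-removeAt : ∀ {R : Fin n → Set} {R′ : Fin n → Set} → (∀ a → R a ⇔ R′ a) → AtSomeEnd Γ R k →
                    ∀ G → Covers Γ R G ⇔ Covers Γ∖k R′ (removeAt G k)
  Covers-removeAt {R} {R′} R⇔R′ covered-k G = mk⇔ restrict extend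
    where
    restrict : Covers Γ R G → Covers Γ∖k R′ (removeAt G k)
    restrict cover e e∈ = map-⊎ (to (R⇔R′ _)) (to (R⇔R′ _)) (cover (punchIn k e) (∈-removeAt⁻ k e∈))

    extend : Covers Γ∖k R′ (removeAt G k) → Covers Γ R G
    extend cover e e∈ with punchInView k e
    ... | at         = covered-k
    ... | punched e′ = map-⊎ (from (R⇔R′ _)) (from (R⇔R′ _)) (cover e′ (∈-removeAt⁺ k e∈))

  GSubShadeFrom-outside : ∀ {S G F} → AtSomeEnd Γ (_∈ˡ S) k →
    GSubShadeFrom Γ S G (insertAt F k outside) ⇔ GSubShadeFrom Γ∖k S (removeAt G k) F
  GSubShadeFrom-outside {G = G} touch = Covers-removeAt Reachable-outside (seeds-reachable touch) G

  GSubShadeFrom-inside : ∀ {S G F} → AtSomeEnd Γ (_∈ˡ S) k →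
    GSubShadeFrom Γ S G (insertAt F k inside) ⇔ GSubShadeFrom Γ∖k (k₁ ∷ k₂ ∷ S) (removeAt G k) F
  GSubShadeFrom-inside {G = G} touch = Covers-removeAt (Reachable-inside touch) (seeds-reachable touch) G

module _ {Γ : Multigraph} {S : List (Vert Γ)} (untouched : ¬ (∃[ e ] AtSomeEnd Γ (_∈ˡ S) e)) where

  Reachable-untouched : ∀ {F a} → Reachable Γ S F a → a ∈ˡ S
  Reachable-untouched (s , s∈S , [])          = s∈S
  Reachable-untouched (s , s∈S , (_ , j) ∷ _) = contradiction (_ , Joins⇒AtSomeEnd {Γ} {R = _∈ˡ S} j s∈S) untouched

  GSubShadeFrom-untouched : ∀ {G F F′} → GSubShadeFrom Γ S G F → GSubShadeFrom Γ S G F′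
  GSubShadeFrom-untouched shade e e∈G =
    contradiction (e , map-⊎ Reachable-untouched Reachable-untouched (shade e e∈G)) untouched

touches? : (Γ : Multigraph) (S : List (Vert Γ)) → Dec (∃[ e ] AtSomeEnd Γ (_∈ˡ S) e)
touches? Γ S = any? λ e → (proj₁ (ends Γ e) ∈? S) ⊎-dec (proj₂ (ends Γ e) ∈? S)
  where open DecMembership (_≟ᶠ_ {nV Γ}) using (_∈?_)

mutual
  signedCount-GSubShadeFrom≡0 : ∀ m {n} (inc : Fin (suc m) → Fin n × Fin n) S G
    (P? : ∀ F → Dec (GSubShadeFrom (graph inc) S G F)) →
    signedCount (suc m) (GSubShadeFrom (graph inc) S G) P? ≡ 0ℤ
  signedCount-GSubShadeFrom≡0 m inc S G P? with touches? (graph inc) S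
  ... | no untouched = signedCount-toggle zero P? λ _ →
          mk⇔ (GSubShadeFrom-untouched untouched) (GSubShadeFrom-untouched untouched)
  ... | yes (k , touch) = trans (signedCount-split k P?) (i≡j⇒i-j≡0 deleted≡contracted)
    where
    open EdgeDeletion inc k
    out? = λ F → P? (insertAt F k outside)
    inn? = λ F → P? (insertAt F k inside)

    deleted? : ∀ F → Dec (GSubShadeFrom Γ∖k S (removeAt G k) F)
    deleted? F = map (GSubShadeFrom-outside touch) (out? F)

    contracted? : ∀ F → Dec (GSubShadeFrom Γ∖k (k₁ ∷ k₂ ∷ S) (removeAt G k) F)
    contracted? F = map (GSubShadeFrom-inside touch) (inn? F)

    deleted≡contracted : signedCount m _ out? ≡ signedCount m _ inn?
    deleted≡contracted = begin
      signedCount m _ out?        ≡⟨ signedCount-cong m out? deleted? (λ _ → GSubShadeFrom-outside touch) ⟩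
      signedCount m _ deleted?    ≡⟨ signedCount-seeds-irrelevant m _ S _ _ deleted? contracted? ⟩
      signedCount m _ contracted? ≡˘⟨ signedCount-cong m inn? contracted? (λ _ → GSubShadeFrom-inside touch) ⟩
      signedCount m _ inn?        ∎
      where open ≡-Reasoning

  signedCount-seeds-irrelevant : ∀ m {n} (inc : Fin m → Fin n × Fin n) S S′ G
    (P? : ∀ F → Dec (GSubShadeFrom (graph inc) S G F)) (Q? : ∀ F → Dec (GSubShadeFrom (graph inc) S′ G F)) →
    signedCount m (GSubShadeFrom (graph inc) S G) P? ≡ signedCount m (GSubShadeFrom (graph inc) S′ G) Q?
  signedCount-seeds-irrelevant zero    inc S S′ G P? Q? =
    trans (signedCount-zero P? λ ()) (sym (signedCount-zero Q? λ ()))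
  signedCount-seeds-irrelevant (suc m) inc S S′ G P? Q? =
    trans (signedCount-GSubShadeFrom≡0 m inc S G P?) (sym (signedCount-GSubShadeFrom≡0 m inc S′ G Q?))

theorem2p10 : (Γ : Multigraph) (v : Vert Γ) (G : Subset (nE Γ))
    → ¬ (nE Γ ≡ 0)
    → (dec : ∀ F → Dec (GSubShade Γ v G F))
    → signedCount (nE Γ) (GSubShade Γ v G) dec ≡ 0ℤ
theorem2p10 record { nE = zero } v G nonempty dec = contradiction refl nonempty
theorem2p10 Γ@record { nE = suc m ; ends = inc } v G _ dec = begin
  signedCount (suc m) (GSubShade Γ v G) dec          ≡⟨ signedCount-cong (suc m) dec P? (λ _ → single-seed) ⟩
  signedCount (suc m) (GSubShadeFrom Γ [ v ] G) P?   ≡⟨ signedCount-GSubShadeFrom≡0 m inc [ v ] G P? ⟩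
  0ℤ                                                 ∎
  where
  open ≡-Reasoning
  single-seed : ∀ {F} → GSubShade Γ v G F ⇔ GSubShadeFrom Γ [ v ] G F
  single-seed = GSubShade⇔GSubShadeFrom-singleton v
  P? : ∀ F → Dec (GSubShadeFrom Γ [ v ] G F)
  P? F = map single-seed (dec F)
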